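{- Consider the file migration problem with file size $D$ on a metric space $(\mathcal{X},d)$, and fix an optimal offline strategy $\textsc{Opt}$, whose file is at $\textsc{op}_s$ at the end of step $s$. Let $\mathcal{R}$ be a subsequence of at most $2D$ consecutive requests of the input, issued at steps $t+1,t+2,\ldots,t+|\mathcal{R}|$. Then $$4\cdot C_{\mathrm{OPT}}(\mathcal{R})\;\ge\;\frac{2|\mathcal{R}|}{D}\cdot[\textsc{op}_t,\mathcal{R},\textsc{op}_{t+|\mathcal{R}|}]+\Big(4-\frac{2|\mathcal{R}|}{D}\Big)\cdot[\textsc{op}_t,\textsc{op}_{t+|\mathcal{R}|}].$$
   Context: File migration: requests $r_1,r_2,\ldots\in\mathcal{X}$; a strategy with file at $\textsc{op}_{s-1}$ before step $s$ pays $d(\textsc{op}_{s-1},r_s)$ to serve $r_s$ and $D\cdot d(\textsc{op}_{s-1},\textsc{op}_s)$ to move the file. $C_{\mathrm{OPT}}(\mathcal{R})=\sum_{s=t+1}^{t+|\mathcal{R}|}\big(d(\textsc{op}_{s-1},r_s)+D\cdot d(\textsc{op}_{s-1},\textsc{op}_s)\big)$ is the cost of $\textsc{Opt}$ during the steps of $\mathcal{R}$. Notation: for points $v_1,v_2$, $[v_1,v_2]=D\cdot d(v_1,v_2)$; for a point $v$ and a multiset $S$ of points, $[v,S]=[S,v]=D\cdot\frac{1}{|S|}\sum_{x\in S}d(v,x)$; for sequences, $[x_1,x_2,\ldots,x_j]=[x_1,x_2]+[x_2,x_3]+\cdots+[x_{j-1},x_j]$, so $[\textsc{op}_t,\mathcal{R},\textsc{op}_{t+|\mathcal{R}|}]=[\textsc{op}_t,\mathcal{R}]+[\mathcal{R},\textsc{op}_{t+|\mathcal{R}|}]$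 with $\mathcal{R}$ regarded as the multiset of its requests. -}

module Defs where

open import Data.Nat using (ℕ; zero; suc) renaming (_+_ to _+ℕ_; _≤_ to _≤ℕ_)
open import Data.Product using (_×_)
open import Relation.Binary.PropositionalEquality using (_≡_; _≢_)
open import Relation.Binary.Structures using (IsTotalOrder)
open import Algebra.Structures using (IsCommutativeRing)

-- A linearly ordered field (the reals are one).  Stating the lemma for
-- every ordered field covers the real-valued case of the paper.
record OrderedField : Set₁ where
  infixl 6 _+_ _-_
  infixl 7 _*_
  infix 4 _≤_ _<_ _≥_
  field
    Carrier : Set
    _+_ _*_ : Carrier → Carrier → Carrier
    -_      : Carrier → Carrier
    0# 1#   : Carrier
    isCommutativeRing : IsCommutativeRing _≡_ _+_ _*_ -_ 0# 1#
    0≢1     : 0# ≢ 1#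
    _⁻¹     : Carrier → Carrier
    ⁻¹-inverse : ∀ x → x ≢ 0# → x * (x ⁻¹) ≡ 1#
    _≤_     : Carrier → Carrier → Set
    isTotalOrder : IsTotalOrder _≡_ _≤_
    +-mono-≤  : ∀ {x y} z → x ≤ y → x + z ≤ y + z
    *-nonneg  : ∀ {x y} → 0# ≤ x → 0# ≤ y → 0# ≤ x * y

  _-_ : Carrier → Carrier → Carrier
  x - y = x + (- y)

  _<_ : Carrier → Carrier → Set
  x < y = (x ≤ y) × (x ≢ y)

  _≥_ : Carrier → Carrier → Set
  x ≥ y = y ≤ x

  fromℕ : ℕ → Carrier
  fromℕ zero    = 0#
  fromℕ (suc n) = 1# + fromℕ n

  -- sumRange a k f = f (a+1) + f (a+2) + ... + f (a+k)
  sumRange : ℕ → ℕ → (ℕ → Carrier) → Carrier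
  sumRange a zero    f = 0#
  sumRange a (suc k) f = sumRange a k f + f (a +ℕ suc k)

record MetricSpace (F : OrderedField) : Set₁ where
  open OrderedField F
  field
    Point : Set
    d     : Point → Point → Carrier
    d-nonneg  : ∀ x y → 0# ≤ d x y
    d-refl    : ∀ x → d x x ≡ 0#
    d-zero    : ∀ x y → d x y ≡ 0# → x ≡ y
    d-sym     : ∀ x y → d x y ≡ d y x
    d-triangle : ∀ x y z → d x z ≤ d x y + d y z

module FileMigration {F : OrderedField} (M : MetricSpace F) (D : OrderedField.Carrier F) where
  open OrderedField F
  open MetricSpace M

  -- Requests: r s is the request of step s (s = 1, ..., n; r 0 unused).
  -- Strategy: op s is the file position at the end of step s, op 0 the initial one.

  stepCost : (ℕ → Point) → (ℕ → Point) → ℕ → Carrier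
  stepCost r op zero    = 0#
  stepCost r op (suc s) = d (op s) (r (suc s)) + D * d (op s) (op (suc s))

  costRange : (ℕ → Point) → (ℕ → Point) → ℕ → ℕ → Carrier
  costRange r op a k = sumRange a k (stepCost r op)

  totalCost : (ℕ → Point) → ℕ → (ℕ → Point) → Carrier
  totalCost r n op = costRange r op 0 n

  IsOptimal : (ℕ → Point) → ℕ → (ℕ → Point) → Set
  IsOptimal r n op = ∀ (op' : ℕ → Point) → op' 0 ≡ op 0 →
                     totalCost r n op ≤ totalCost r n op'

  ⟦_,_⟧ : Point → Point → Carrier
  ⟦ v₁ , v₂ ⟧ = D * d v₁ v₂

  -- [v, R] = [R, v] = D · (1/|R|) Σ_{x ∈ R} d(v, x), where R is the multiset
  -- of requests r_{t+1}, ..., r_{t+k}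
  bracketR : Point → (ℕ → Point) → ℕ → ℕ → Carrier
  bracketR v r t k = D * ((fromℕ k) ⁻¹ * sumRange t k (λ s → d v (r s)))

  bracketVRW : Point → (ℕ → Point) → ℕ → ℕ → Point → Carrier
  bracketVRW v r t k w = bracketR v r t k + bracketR w r t k

module Submission where

-- Write C(R) = Q + D·M, with Q the service distances and M the total distance
-- the file travels inside the window.  For a request r_s served from p = op_{s-1},
-- the triangle inequality gives d(a,r_s) + d(b,r_s) ≤ 2·d(p,r_s) + d(a,p) + d(p,b),
-- and d(a,p) + d(p,b) ≤ M since p lies on the path of the file.  Summing over
-- the window gives  A + B ≤ 2Q + k·M  (A, B the request-distance sums of a, b);
-- also d(a,b) ≤ M.  A purely ordered-ring argument (the trade-off lemma) then
-- combines these with k ≤ 2D into the claimed inequality, once the field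
-- factors k·k⁻¹ and D·D⁻¹ in the bracket notation have been cancelled.

open import Defs
open import Data.Nat using (ℕ; zero; suc; _∸_) renaming (_+_ to _+ℕ_; _≤_ to _≤ℕ_; _<_ to _<ℕ_; _*_ to _*ℕ_)
import Data.Nat.Properties as ℕ
open import Data.Product using (Σ; _×_; _,_)
open import Data.Sum using (inj₁; inj₂)
open import Data.Maybe using (nothing)
open import Relation.Binary.PropositionalEquality
  using (_≡_; _≢_; refl; sym; trans; cong; cong₂; subst; subst₂; module ≡-Reasoning)
open import Relation.Binary.Bundles using (Poset)
import Relation.Binary.Reasoning.PartialOrder
open import Relation.Binary.Structures using (IsTotalOrder)
open import Algebra.Structures using (IsCommutativeRing)
open import Algebra.Bundles using (CommutativeRing)

module OrderedFieldFacts (F : OrderedField) where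
  open OrderedField F public
  open IsTotalOrder isTotalOrder public
    using (antisym; total) renaming (refl to ≤-refl; trans to ≤-trans; reflexive to ≤-reflexive)
  open IsCommutativeRing isCommutativeRing public
    using (+-identityˡ; +-identityʳ; *-identityʳ; zeroˡ; zeroʳ; distribˡ; distribʳ;
           -‿inverseʳ; +-comm; +-assoc)

  commutativeRing : CommutativeRing _ _
  commutativeRing = record { isCommutativeRing = isCommutativeRing }

  poset : Poset _ _ _
  poset = record { isPartialOrder = IsTotalOrder.isPartialOrder isTotalOrder }

  module ≤-Reasoning = Relation.Binary.Reasoning.PartialOrder poset

  -- commutative-semiring normalisation, treating negation and inverse as atoms
  open import Algebra.Solver.Ring.NaturalCoefficients
    (CommutativeRing.commutativeSemiring commutativeRing) (λ _ _ → nothing) public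
    using (solve; _:=_; _:+_; _:*_; con)
  open import Algebra.Properties.Ring (CommutativeRing.ring commutativeRing)
    using (-1*x≈-x; -‿involutive; -‿distribˡ-*)
  open import Algebra.Properties.Semiring.Mult (CommutativeRing.semiring commutativeRing)
    using (×1-homo-*) renaming (_×_ to _×ₙ_)

  +-monoʳ-≤ : ∀ z {x y} → x ≤ y → z + x ≤ z + y
  +-monoʳ-≤ z {x} {y} x≤y = subst₂ _≤_ (+-comm x z) (+-comm y z) (+-mono-≤ z x≤y)

  +-mono₂-≤ : ∀ {x y u v} → x ≤ y → u ≤ v → x + u ≤ y + v
  +-mono₂-≤ {y = y} {u} x≤y u≤v = ≤-trans (+-mono-≤ u x≤y) (+-monoʳ-≤ y u≤v)

  ≤-+-nonneg : ∀ x {c} → 0# ≤ c → x ≤ x + c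
  ≤-+-nonneg x 0≤c = subst (_≤ x + _) (+-identityʳ x) (+-monoʳ-≤ x 0≤c)

  nonneg-+ : ∀ {x y} → 0# ≤ x → 0# ≤ y → 0# ≤ x + y
  nonneg-+ {x} {y} 0≤x 0≤y = ≤-trans 0≤y (subst (_≤ x + y) (+-identityˡ y) (+-mono-≤ y 0≤x))

  -- x ≤ y gives y = x + u with a non-negative slack u; this reduces the
  -- inequalities below to semiring identities
  slack : ∀ {x y} → x ≤ y → Σ Carrier λ u → 0# ≤ u × x + u ≡ y
  slack {x} {y} x≤y = y - x , subst (_≤ y - x) (-‿inverseʳ x) (+-mono-≤ (- x) x≤y) , x+[y-x]≡y
    where
    x+[y-x]≡y : x + (y - x) ≡ y
    x+[y-x]≡y = trans (solve 3 (λ x y n → x :+ (y :+ n) := y :+ (x :+ n)) refl x y (- x))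
                      (trans (cong (y +_) (-‿inverseʳ x)) (+-identityʳ y))

  *-monoˡ-≤ : ∀ {c x y} → 0# ≤ c → x ≤ y → c * x ≤ c * y
  *-monoˡ-≤ {c} {x} 0≤c x≤y with slack x≤y
  ... | u , 0≤u , refl = subst (c * x ≤_) (sym (distribˡ c x u)) (≤-+-nonneg (c * x) (*-nonneg 0≤c 0≤u))

  ≤-move-right : ∀ {x v z} → x ≤ z + v → x - v ≤ z
  ≤-move-right {x} {v} {z} x≤z+v = subst (x - v ≤_) z+v-v≡z (+-mono-≤ (- v) x≤z+v)
    where
    z+v-v≡z : (z + v) - v ≡ z
    z+v-v≡z = trans (+-assoc z v (- v)) (trans (cong (z +_) (-‿inverseʳ v)) (+-identityʳ z))

  weighted-difference : ∀ P W Y E → P * W + (Y - P) * E ≡ (P * W + Y * E) - P * E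
  weighted-difference P W Y E = begin
    P * W + (Y - P) * E            ≡⟨ cong (P * W +_) (distribʳ E Y (- P)) ⟩
    P * W + (Y * E + - P * E)      ≡⟨ cong (λ z → P * W + (Y * E + z)) (sym (-‿distribˡ-* P E)) ⟩
    P * W + (Y * E + - (P * E))    ≡⟨ sym (+-assoc (P * W) (Y * E) (- (P * E))) ⟩
    (P * W + Y * E) - P * E        ∎
    where open ≡-Reasoning

  -- in an ordered field 1 is positive: otherwise 0 ≤ −1, hence 0 ≤ (−1)² = 1
  0≤1 : 0# ≤ 1#
  0≤1 with total 0# 1#
  ... | inj₁ 0≤1 = 0≤1
  ... | inj₂ 1≤0 = subst (0# ≤_) [-1]²≡1 (*-nonneg 0≤-1 0≤-1)
    where
    0≤-1 : 0# ≤ - 1#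
    0≤-1 = subst₂ _≤_ (-‿inverseʳ 1#) (+-identityˡ (- 1#)) (+-mono-≤ (- 1#) 1≤0)
    [-1]²≡1 : - 1# * - 1# ≡ 1#
    [-1]²≡1 = trans (-1*x≈-x (- 1#)) (-‿involutive 1#)

  fromℕ-nonneg : ∀ n → 0# ≤ fromℕ n
  fromℕ-nonneg zero    = ≤-refl
  fromℕ-nonneg (suc n) = nonneg-+ 0≤1 (fromℕ-nonneg n)

  fromℕ-suc≢0 : ∀ n → fromℕ (suc n) ≢ 0#
  fromℕ-suc≢0 n 1+n≡0 = 0≢1 (antisym 0≤1 1≤0)
    where
    1≤0 : 1# ≤ 0#
    1≤0 = subst₂ _≤_ (+-identityʳ 1#) 1+n≡0 (+-monoʳ-≤ 1# (fromℕ-nonneg n))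

  two-* : ∀ x → fromℕ 2 * x ≡ x + x
  two-* = solve 1 (λ x → (con 1 :+ (con 1 :+ con 0)) :* x := x :+ x) refl

  fromℕ≡×1 : ∀ n → fromℕ n ≡ n ×ₙ 1#
  fromℕ≡×1 zero    = refl
  fromℕ≡×1 (suc n) = cong (1# +_) (fromℕ≡×1 n)

  fromℕ-* : ∀ m n → fromℕ (m *ℕ n) ≡ fromℕ m * fromℕ n
  fromℕ-* m n = trans (fromℕ≡×1 (m *ℕ n))
    (trans (×1-homo-* m n) (sym (cong₂ _*_ (fromℕ≡×1 m) (fromℕ≡×1 n))))

  -- Cancelling the field factors of the weight P = c·K·D⁻¹ (with K·K⁻¹ = D·D⁻¹ = 1)
  -- against the request brackets [v,R] = D·(K⁻¹·A) and [w,R] = D·(K⁻¹·B).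
  weight-bracketR : ∀ c K Ki D Di A B → K * Ki ≡ 1# → D * Di ≡ 1# →
                    (c * K * Di) * (D * (Ki * A) + D * (Ki * B)) ≡ c * (A + B)
  weight-bracketR c K Ki D Di A B KKi≡1 DDi≡1 = begin
    (c * K * Di) * (D * (Ki * A) + D * (Ki * B))
      ≡⟨ solve 7 (λ c K Ki D Di A B → (c :* K :* Di) :* (D :* (Ki :* A) :+ D :* (Ki :* B))
                                     := c :* (A :+ B) :* (K :* Ki) :* (D :* Di)) refl c K Ki D Di A B ⟩
    c * (A + B) * (K * Ki) * (D * Di)
      ≡⟨ cong₂ (λ u v → c * (A + B) * u * v) KKi≡1 DDi≡1 ⟩
    c * (A + B) * 1# * 1#
      ≡⟨ trans (*-identityʳ _) (*-identityʳ _) ⟩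
    c * (A + B) ∎
    where open ≡-Reasoning

  weight-bracket : ∀ c K D Di e → D * Di ≡ 1# → (c * K * Di) * (D * e) ≡ c * K * e
  weight-bracket c K D Di e DDi≡1 = begin
    (c * K * Di) * (D * e)   ≡⟨ solve 5 (λ c K D Di e → (c :* K :* Di) :* (D :* e) := c :* K :* e :* (D :* Di))
                                       refl c K D Di e ⟩
    c * K * e * (D * Di)     ≡⟨ cong (c * K * e *_) DDi≡1 ⟩
    c * K * e * 1#           ≡⟨ *-identityʳ _ ⟩
    c * K * e                ∎
    where open ≡-Reasoning

  -- Writing c·D = K + u and M = e + w with u, w ≥ 0, the gap between the two
  -- sides is at least c·u·w ≥ 0.
  trade-off : ∀ {c X Q K M D e} → 0# ≤ c → X ≤ c * Q + K * M → K ≤ c * D → e ≤ M →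
              c * X + c * c * (D * e) ≤ c * c * (Q + D * M) + c * K * e
  trade-off {c} {X} {Q} {K} {M} {D} {e} 0≤c X≤cQ+KM K≤cD e≤M with slack K≤cD | slack e≤M
  ... | u , 0≤u , K+u≡cD | w , 0≤w , refl = begin
    c * X + c * c * (D * e)
      ≤⟨ +-mono-≤ _ (*-monoˡ-≤ 0≤c X≤cQ+KM) ⟩
    c * (c * Q + K * (e + w)) + c * c * (D * e)
      ≤⟨ ≤-+-nonneg _ (*-nonneg 0≤c (*-nonneg 0≤u 0≤w)) ⟩
    c * (c * Q + K * (e + w)) + c * c * (D * e) + c * (u * w)
      ≡⟨ solve 7 (λ c Q K e w u D →
           c :* (c :* Q :+ K :* (e :+ w)) :+ c :* c :* (D :* e) :+ c :* (u :* w)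
           := c :* (c :* Q :+ K :* (e :+ w)) :+ c :* (c :* D) :* e :+ c :* (u :* w))
           refl c Q K e w u D ⟩
    c * (c * Q + K * (e + w)) + c * (c * D) * e + c * (u * w)
      ≡⟨ cong (λ z → c * (c * Q + K * (e + w)) + c * z * e + c * (u * w)) (sym K+u≡cD) ⟩
    c * (c * Q + K * (e + w)) + c * (K + u) * e + c * (u * w)
      ≡⟨ solve 6 (λ c Q K e w u →
           c :* (c :* Q :+ K :* (e :+ w)) :+ c :* (K :+ u) :* e :+ c :* (u :* w)
           := c :* c :* Q :+ c :* (K :+ u) :* (e :+ w) :+ c :* K :* e)
           refl c Q K e w u ⟩
    c * c * Q + c * (K + u) * (e + w) + c * K * e
      ≡⟨ cong (λ z → c * c * Q + c * z * (e + w) + c * K * e) K+u≡cD ⟩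
    c * c * Q + c * (c * D) * (e + w) + c * K * e
      ≡⟨ solve 5 (λ c Q D m y → c :* c :* Q :+ c :* (c :* D) :* m :+ y
                              := c :* c :* (Q :+ D :* m) :+ y) refl c Q D (e + w) (c * K * e) ⟩
    c * c * (Q + D * (e + w)) + c * K * e ∎
    where open ≤-Reasoning

module Sums (F : OrderedField) where
  open OrderedFieldFacts F

  sum-cong : ∀ a k {f g : ℕ → Carrier} → (∀ s → f s ≡ g s) → sumRange a k f ≡ sumRange a k g
  sum-cong a zero    f≡g = refl
  sum-cong a (suc k) f≡g = cong₂ _+_ (sum-cong a k f≡g) (f≡g (a +ℕ suc k))

  sum-+ : ∀ a k (f g : ℕ → Carrier) →
          sumRange a k (λ s → f s + g s) ≡ sumRange a k f + sumRange a k g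
  sum-+ a zero    f g = sym (+-identityˡ 0#)
  sum-+ a (suc k) f g = trans (cong (_+ (f s + g s)) (sum-+ a k f g))
    (solve 4 (λ p q x y → (p :+ q) :+ (x :+ y) := (p :+ x) :+ (q :+ y)) refl _ _ _ _)
    where s = a +ℕ suc k

  sum-*ˡ : ∀ a k c (f : ℕ → Carrier) → sumRange a k (λ s → c * f s) ≡ c * sumRange a k f
  sum-*ˡ a zero    c f = sym (zeroʳ c)
  sum-*ˡ a (suc k) c f = trans (cong (_+ c * f (a +ℕ suc k)) (sum-*ˡ a k c f))
    (sym (distribˡ c _ _))

  sum-const : ∀ a k c → sumRange a k (λ _ → c) ≡ fromℕ k * c
  sum-const a zero    c = sym (zeroˡ c)
  sum-const a (suc k) c = trans (cong (_+ c) (sum-const a k c))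
    (solve 2 (λ m c → m :* c :+ c := (con 1 :+ m) :* c) refl (fromℕ k) c)

  sum-mono : ∀ a k {f g : ℕ → Carrier} →
             (∀ i → i <ℕ k → f (suc (a +ℕ i)) ≤ g (suc (a +ℕ i))) → sumRange a k f ≤ sumRange a k g
  sum-mono a zero    f≤g = ≤-refl
  sum-mono a (suc k) {f} {g} f≤g = +-mono₂-≤ (sum-mono a k (λ i i<k → f≤g i (ℕ.m<n⇒m<1+n i<k)))
    (subst (λ s → f s ≤ g s) (sym (ℕ.+-suc a k)) (f≤g k (ℕ.n<1+n k)))

  sum-split : ∀ a i j (f : ℕ → Carrier) →
              sumRange a (i +ℕ j) f ≡ sumRange a i f + sumRange (a +ℕ i) j f
  sum-split a i zero    f = trans (cong (λ m → sumRange a m f) (ℕ.+-identityʳ i)) (sym (+-identityʳ _))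
  sum-split a i (suc j) f = begin
    sumRange a (i +ℕ suc j) f                              ≡⟨ cong (λ m → sumRange a m f) (ℕ.+-suc i j) ⟩
    sumRange a (i +ℕ j) f + f (a +ℕ suc (i +ℕ j))          ≡⟨ cong₂ _+_ (sum-split a i j f) (cong f index) ⟩
    (sumRange a i f + sumRange (a +ℕ i) j f) + f ((a +ℕ i) +ℕ suc j)
                                                           ≡⟨ +-assoc _ _ _ ⟩
    sumRange a i f + sumRange (a +ℕ i) (suc j) f           ∎
    where
    open ≡-Reasoning
    index : a +ℕ suc (i +ℕ j) ≡ (a +ℕ i) +ℕ suc j
    index = trans (cong (a +ℕ_) (sym (ℕ.+-suc i j))) (sym (ℕ.+-assoc a i (suc j)))

module Paths {F : OrderedField} (X : MetricSpace F) where
  open OrderedFieldFacts F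
  open Sums F
  open MetricSpace X

  legLength : (ℕ → Point) → ℕ → Carrier
  legLength x zero    = 0#
  legLength x (suc s) = d (x s) (x (suc s))

  path-bound : ∀ x a j → d (x a) (x (a +ℕ j)) ≤ sumRange a j (legLength x)
  path-bound x a zero = ≤-reflexive (trans (cong (λ m → d (x a) (x m)) (ℕ.+-identityʳ a)) (d-refl (x a)))
  path-bound x a (suc j) rewrite ℕ.+-suc a j =
    ≤-trans (d-triangle (x a) (x (a +ℕ j)) (x (suc (a +ℕ j)))) (+-mono-≤ _ (path-bound x a j))

  detour-bound : ∀ x a i k → i ≤ℕ k →
                 d (x a) (x (a +ℕ i)) + d (x (a +ℕ i)) (x (a +ℕ k)) ≤ sumRange a k (legLength x)
  detour-bound x a i k i≤k = begin
    d (x a) (x (a +ℕ i)) + d (x (a +ℕ i)) (x (a +ℕ k))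
      ≡⟨ cong (λ m → d (x a) (x (a +ℕ i)) + d (x (a +ℕ i)) (x m)) (sym a+i+[k-i]≡a+k) ⟩
    d (x a) (x (a +ℕ i)) + d (x (a +ℕ i)) (x ((a +ℕ i) +ℕ (k ∸ i)))
      ≤⟨ +-mono₂-≤ (path-bound x a i) (path-bound x (a +ℕ i) (k ∸ i)) ⟩
    sumRange a i (legLength x) + sumRange (a +ℕ i) (k ∸ i) (legLength x)
      ≡⟨ sym (sum-split a i (k ∸ i) (legLength x)) ⟩
    sumRange a (i +ℕ (k ∸ i)) (legLength x)
      ≡⟨ cong (λ m → sumRange a m (legLength x)) (ℕ.m+[n∸m]≡n i≤k) ⟩
    sumRange a k (legLength x) ∎
    where
    open ≤-Reasoning
    a+i+[k-i]≡a+k : (a +ℕ i) +ℕ (k ∸ i) ≡ a +ℕ k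
    a+i+[k-i]≡a+k = trans (ℕ.+-assoc a i (k ∸ i)) (cong (a +ℕ_) (ℕ.m+[n∸m]≡n i≤k))

  two-point-bound : ∀ a b p y →
                    d a y + d b y ≤ fromℕ 2 * d p y + (d a p + d p b)
  two-point-bound a b p y = ≤-trans
    (+-mono₂-≤ (d-triangle a p y) (subst (λ z → d b y ≤ z + d p y) (d-sym b p) (d-triangle b p y)))
    (≤-reflexive (trans (solve 3 (λ q α β → (α :+ q) :+ (β :+ q) := (q :+ q) :+ (α :+ β)) refl (d p y) (d a p) (d p b))
                        (cong (_+ (d a p + d p b)) (sym (two-* (d p y))))))

module Strategy {F : OrderedField} (X : MetricSpace F) (D : OrderedField.Carrier F) (r op : ℕ → MetricSpace.Point X) where
  open OrderedFieldFacts F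
  open Sums F
  open MetricSpace X
  open Paths X
  open FileMigration X D

  serviceDist : ℕ → Carrier
  serviceDist zero    = 0#
  serviceDist (suc s) = d (op s) (r (suc s))

  stepCost-split : ∀ s → stepCost r op s ≡ serviceDist s + D * legLength op s
  stepCost-split zero    = sym (trans (cong (0# +_) (zeroʳ D)) (+-identityˡ 0#))
  stepCost-split (suc s) = refl

  cost-split : ∀ t k → costRange r op t k ≡ sumRange t k serviceDist + D * sumRange t k (legLength op)
  cost-split t k = trans (sum-cong t k stepCost-split)
    (trans (sum-+ t k serviceDist _) (cong (sumRange t k serviceDist +_) (sum-*ˡ t k D (legLength op))))

  request-bound : ∀ t k i → i ≤ℕ k →
                  d (op t) (r (suc (t +ℕ i))) + d (op (t +ℕ k)) (r (suc (t +ℕ i)))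
                  ≤ fromℕ 2 * serviceDist (suc (t +ℕ i)) + sumRange t k (legLength op)
  request-bound t k i i≤k =
    ≤-trans (two-point-bound (op t) (op (t +ℕ k)) (op (t +ℕ i)) (r (suc (t +ℕ i))))
            (+-monoʳ-≤ _ (detour-bound op t i k i≤k))

  window-bound : ∀ t k →
                 sumRange t k (λ s → d (op t) (r s)) + sumRange t k (λ s → d (op (t +ℕ k)) (r s))
                 ≤ fromℕ 2 * sumRange t k serviceDist + fromℕ k * sumRange t k (legLength op)
  window-bound t k = begin
    sumRange t k (λ s → d a (r s)) + sumRange t k (λ s → d b (r s))
      ≡⟨ sym (sum-+ t k _ _) ⟩
    sumRange t k (λ s → d a (r s) + d b (r s))
      ≤⟨ sum-mono t k (λ i i<k → request-bound t k i (ℕ.<⇒≤ i<k)) ⟩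
    sumRange t k (λ s → fromℕ 2 * serviceDist s + M)
      ≡⟨ sum-+ t k _ _ ⟩
    sumRange t k (λ s → fromℕ 2 * serviceDist s) + sumRange t k (λ _ → M)
      ≡⟨ cong₂ _+_ (sum-*ˡ t k (fromℕ 2) serviceDist) (sum-const t k M) ⟩
    fromℕ 2 * sumRange t k serviceDist + fromℕ k * M ∎
    where
    open ≤-Reasoning
    a b : Point
    a = op t
    b = op (t +ℕ k)
    M : Carrier
    M = sumRange t k (legLength op)

lemma3 : (F : OrderedField) (M : MetricSpace F) →
    let open OrderedField F
        open MetricSpace M
    in (D : Carrier) → 0# < D →
       (n : ℕ) (r : ℕ → Point) (op : ℕ → Point) →
       FileMigration.IsOptimal M D r n op →
       (t k : ℕ) → 1 ≤ℕ k → t +ℕ k ≤ℕ n → fromℕ k ≤ fromℕ 2 * D →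
       fromℕ 4 * FileMigration.costRange M D r op t k
         ≥ (fromℕ 2 * fromℕ k * D ⁻¹) * FileMigration.bracketVRW M D (op t) r t k (op (t +ℕ k))
           + (fromℕ 4 - fromℕ 2 * fromℕ k * D ⁻¹) * FileMigration.⟦_,_⟧ M D (op t) (op (t +ℕ k))
lemma3 F X D (_ , 0≢D) _ r op _ t k@(suc k′) _ _ k≤2D = begin
  P * W + (fromℕ 4 - P) * E
    ≡⟨ weighted-difference P W (fromℕ 4) E ⟩
  (P * W + fromℕ 4 * E) - P * E
    ≡⟨ cong₂ (λ u v → (u + fromℕ 4 * E) - v)
             (weight-bracketR two K (K ⁻¹) D (D ⁻¹) A B K·K⁻¹≡1 D·D⁻¹≡1)
             (weight-bracket two K D (D ⁻¹) e D·D⁻¹≡1) ⟩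
  (two * (A + B) + fromℕ 4 * E) - two * K * e
    ≡⟨ cong (λ c → (two * (A + B) + c * E) - two * K * e) four≡two·two ⟩
  (two * (A + B) + two * two * E) - two * K * e
    ≤⟨ ≤-move-right (trade-off (fromℕ-nonneg 2) (window-bound t k) k≤2D (path-bound op t k)) ⟩
  two * two * (Q + D * M)
    ≡⟨ cong₂ _*_ (sym four≡two·two) (sym (cost-split t k)) ⟩
  fromℕ 4 * FileMigration.costRange X D r op t k ∎
  where
  open OrderedFieldFacts F
  open MetricSpace X
  open Paths X
  open Strategy X D r op
  open ≤-Reasoning
  two K P W e E A B Q M : Carrier
  two = fromℕ 2
  K   = fromℕ k
  P   = two * K * D ⁻¹
  W   = FileMigration.bracketVRW X D (op t) r t k (op (t +ℕ k))
  e   = d (op t) (op (t +ℕ k))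
  E   = D * e
  A   = sumRange t k (λ s → d (op t) (r s))
  B   = sumRange t k (λ s → d (op (t +ℕ k)) (r s))
  Q   = sumRange t k serviceDist
  M   = sumRange t k (legLength op)
  K·K⁻¹≡1 : K * K ⁻¹ ≡ 1#
  K·K⁻¹≡1 = ⁻¹-inverse K (fromℕ-suc≢0 k′)
  D·D⁻¹≡1 : D * D ⁻¹ ≡ 1#
  D·D⁻¹≡1 = ⁻¹-inverse D (λ D≡0 → 0≢D (sym D≡0))
  four≡two·two : fromℕ 4 ≡ two * two
  four≡two·two = fromℕ-* 2 2
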